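{- Let $w$ be a word, $F$ an $f$-factorization of $w$, and $v$ a cover of $w$. Then for $\lambda=[|v|+1..|w|]$ we have $|F_\lambda|\le \lfloor 2|w|/|v|\rfloor$.
   Context: A factorization of $w$ is a sequence $F=(f_1,\dots,f_K)$ of words with $w=f_1f_2\cdots f_K$ such that for each $k$, $f_k$ is a subword of $f_1\cdots f_{k-1}$ or a single letter; $|F|=K$. An $f$-factorization is a factorization with the minimum possible number of factors. Each factor occupies an interval of positions of $w$; for an interval $\lambda$ of positions, $F_\lambda$ is the set of factors of $F$ which start and end within $\lambda$. A word $v$ is a cover of $w$ if every position of $w$ lies within some occurrence of $v$ in $w$. Intervals are $[a..b]=\{a,\dots,b\}$. -}

module Defs where

open import Data.Nat using (ℕ; zero; suc; _+_; _≤_; _<_; _≤?_)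
open import Data.List using (List; []; _∷_; _++_; length; concat; [_]; filter)
open import Data.Product using (Σ; _×_; _,_; ∃; ∃-syntax; proj₁; proj₂)
open import Data.Sum using (_⊎_)
open import Data.Unit using (⊤)
open import Relation.Binary.PropositionalEquality using (_≡_)
open import Relation.Nullary using (Dec; yes; no)
open import Relation.Nullary.Decidable using (_×-dec_)

Subword : {A : Set} → List A → List A → Set
Subword {A} u t = Σ (List A) λ x → Σ (List A) λ y → t ≡ x ++ (u ++ y)

ValidFactors : {A : Set} → List A → List (List A) → Set
ValidFactors prev [] = ⊤
ValidFactors {A} prev (f ∷ F) =
  (Subword f prev ⊎ (Σ A λ a → f ≡ [ a ])) × ValidFactors (prev ++ f) F

IsFactorization : {A : Set} → List A → List (List A) → Set
IsFactorization w F = (concat F ≡ w) × ValidFactors [] F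

IsFFactorization : {A : Set} → List A → List (List A) → Set
IsFFactorization {A} w F =
  IsFactorization w F × ((G : List (List A)) → IsFactorization w G → length F ≤ length G)

-- v occurs in w at 0-based offset i (occupying positions i+1 .. i+|v|, 1-based)
OccursAt : {A : Set} → List A → List A → ℕ → Set
OccursAt {A} v w i = Σ (List A) λ x → Σ (List A) λ y → (w ≡ x ++ (v ++ y)) × (length x ≡ i)

IsCover : {A : Set} → List A → List A → Set
IsCover v w = (p : ℕ) → 1 ≤ p → p ≤ length w →
  ∃[ i ] (OccursAt v w i × (i + 1 ≤ p) × (p ≤ i + length v))

-- factors paired with their 0-based start offsets; factor (s , f) occupies
-- the 1-based positions [s+1 .. s+|f|]
withStarts : {A : Set} → ℕ → List (List A) → List (ℕ × List A)
withStarts s [] = []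
withStarts s (f ∷ F) = (s , f) ∷ withStarts (s + length f) F

StartsEndsIn : {A : Set} → ℕ → ℕ → ℕ × List A → Set
StartsEndsIn a b (s , f) = (a ≤ s + 1) × (s + length f ≤ b)

startsEndsIn? : {A : Set} → (a b : ℕ) → (p : ℕ × List A) → Dec (StartsEndsIn a b p)
startsEndsIn? a b (s , f) = (a ≤? s + 1) ×-dec (s + length f ≤? b)

FactorsIn : {A : Set} → ℕ → ℕ → List (List A) → List (ℕ × List A)
FactorsIn a b F = filter (startsEndsIn? a b) (withStarts 0 F)

module Submission where

-- Let n = |w| and L = |v|.  The factors of F lying in [L+1..n] all start at a
-- position ≥ L, so it suffices to show: if a prefix `prev` of w has length
-- p ≥ L, then the remaining suffix can be cut into at most 2n/(L+1) pieces,
-- each a subword of what precedes it.  Minimality of F then bounds the number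
-- of its factors after `prev`.
--
-- Pieces are produced greedily.  Position p is anchored by an occurrence d₀ of
-- v covering it.  Among the occurrences reachable from d₀ by repeatedly passing
-- to the occurrence covering the end of the current one, pick the last one d
-- still starting at or before p ("jump", a fact about covering families of
-- intervals, proved in CoverGeometry).  The piece from p to d + L is a suffix
-- of v (lemma `overhang`), hence a subword of prev since v is a prefix of w.
-- The potential p + d₀ grows by at least L + 1 per piece and never exceeds
-- 2n, which gives the count.

open import Defs
open import Data.Nat using (ℕ; _+_; _*_; _/_; _≤_; NonZero)
open import Data.List using (List; length)
open import Data.Nat using (suc; _<_; _∸_; _≤?_; _<?_; z≤n; s≤s)
open import Data.Nat.Properties
open import Data.Nat.DivMod using (m*n/n≡m; /-monoˡ-≤)
open import Data.Nat.Induction using (<-wellFounded)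
open import Data.Nat.Tactic.RingSolver using (solve-∀)
open import Induction.WellFounded using (Acc; acc)
open import Data.List using ([]; _∷_; _++_; concat; filter)
open import Data.List.Properties using (length-++; length-++-≤ˡ; ++-assoc; ++-identityʳ; length-filter; filter-reject; ∷-injective)
open import Data.Product using (Σ; _×_; _,_)
open import Data.Sum using (_⊎_; inj₁; inj₂)
open import Data.Unit using (tt)
open import Data.Empty using (⊥-elim)
open import Relation.Nullary using (Dec; yes; no; ¬_)
open import Relation.Binary.PropositionalEquality

++-split : {A : Set} (a b c d : List A) → a ++ b ≡ c ++ d → length a ≤ length c →
           Σ (List A) λ e → (c ≡ a ++ e) × (b ≡ e ++ d)
++-split []      b c       d eq _ = c , refl , eq
++-split (x ∷ a) b []      d eq ()
++-split (x ∷ a) b (y ∷ c) d eq (s≤s |a|≤|c|) with ∷-injective eq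
... | refl , eq′ with ++-split a b c d eq′ |a|≤|c|
... | e , c≡ae , b≡ed = e , cong (x ∷_) c≡ae , b≡ed

Overhang : {A : Set} → List A → List A → ℕ → Set
Overhang {A} prev rest end = Σ (List A) λ piece → Σ (List A) λ rest′ →
  (rest ≡ piece ++ rest′) × Subword piece prev × (length prev + length piece ≡ end)

length-++-known : {A : Set} {u : List A} (x e : List A) {d : ℕ} → u ≡ x ++ e → length x ≡ d →
                  length u ≡ d + length e
length-++-known x e u≡xe |x|≡d =
  trans (cong length u≡xe) (trans (length-++ x) (cong (_+ length e) |x|≡d))

-- If v is a prefix of prev and an occurrence of v at offset d straddles the
-- end of prev, then the part of that occurrence beyond prev is the next piece
-- of the word, and it is a subword of prev (being a suffix of v).
overhang : {A : Set} {w v prev rest z : List A} {d : ℕ} →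
           prev ≡ v ++ z → OccursAt v w d → prev ++ rest ≡ w →
           d ≤ length prev → length prev ≤ d + length v → Overhang prev rest (d + length v)
overhang {v = v} {prev} {rest} {z} {d} prev≡vz (x , y , w≡xvy , |x|≡d) prev++rest≡w d≤p p≤d+L
  with ++-split x (v ++ y) prev rest (trans (sym w≡xvy) (sym prev++rest≡w))
                (subst (_≤ length prev) (sym |x|≡d) d≤p)
... | e , prev≡xe , vy≡e++rest
  with ++-split e rest v y (sym vy≡e++rest)
         (+-cancelˡ-≤ d (length e) (length v)
           (subst (_≤ d + length v) (length-++-known x e prev≡xe |x|≡d) p≤d+L))
... | piece , v≡e++piece , rest≡piece++y =
  piece , y , rest≡piece++y , (e , z , prev≡e++piece++z) , |prev++piece|≡d+|v|
  where
  open ≡-Reasoning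
  prev≡e++piece++z : prev ≡ e ++ (piece ++ z)
  prev≡e++piece++z = begin
    prev                ≡⟨ prev≡vz ⟩
    v ++ z              ≡⟨ cong (_++ z) v≡e++piece ⟩
    (e ++ piece) ++ z   ≡⟨ ++-assoc e piece z ⟩
    e ++ (piece ++ z)   ∎
  |prev++piece|≡d+|v| : length prev + length piece ≡ d + length v
  |prev++piece|≡d+|v| = begin
    length prev + length piece         ≡⟨ cong (_+ length piece) (length-++-known x e prev≡xe |x|≡d) ⟩
    d + length e + length piece        ≡⟨ +-assoc d (length e) (length piece) ⟩
    d + (length e + length piece)      ≡⟨ cong (d +_) (sym (length-++-known e piece v≡e++piece refl)) ⟩
    d + length v                       ∎

Shortest : {A : Set} → List A → List (List A) → Set
Shortest {A} prev F = (G : List (List A)) → ValidFactors prev G → concat G ≡ concat F → length F ≤ length G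

-- Shortness is inherited by the tail: a shorter continuation of prev ++ f
-- would give a shorter continuation of prev by putting f in front.
shortest-tail : {A : Set} {prev f : List A} {F : List (List A)} →
                (Subword f prev ⊎ Σ A λ a → f ≡ a ∷ []) → Shortest prev (f ∷ F) → Shortest (prev ++ f) F
shortest-tail {f = f} valid-f shortest G valid-G concat-G =
  ≤-pred (shortest (f ∷ G) (valid-f , valid-G) (cong (f ++_) concat-G))

length-withStarts : {A : Set} (s : ℕ) (F : List (List A)) → length (withStarts s F) ≡ length F
length-withStarts s []      = refl
length-withStarts s (f ∷ F) = cong suc (length-withStarts (s + length f) F)

pay-for-piece : ∀ k s r q N → k * s + q ≤ N → s + r ≤ q → suc k * s + r ≤ N
pay-for-piece k s r q N bound s+r≤q = begin
  suc k * s + r     ≡⟨ +-assoc s (k * s) r ⟩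
  s + (k * s + r)   ≡⟨ +-comm s (k * s + r) ⟩
  k * s + r + s     ≡⟨ +-assoc (k * s) r s ⟩
  k * s + (r + s)   ≡⟨ cong (k * s +_) (+-comm r s) ⟩
  k * s + (s + r)   ≤⟨ +-monoʳ-≤ (k * s) s+r≤q ⟩
  k * s + q         ≤⟨ bound ⟩
  N                 ∎
  where open ≤-Reasoning

module CoverGeometry (n L : ℕ) (Occ : ℕ → Set)
                     (cover : ∀ q → q < n → Σ ℕ λ i → Occ i × i ≤ q × q < i + L) where

  Anchor : ℕ → ℕ → Set
  Anchor p d = d ≤ p × (p < n → Occ d × p < d + L)

  anchor : ∀ p → Σ ℕ (Anchor p)
  anchor p with p <? n
  ... | yes p<n with cover p p<n
  ...   | i , occ , i≤p , p<i+L = i , i≤p , λ _ → occ , p<i+L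
  anchor p | no p≮n = p , ≤-refl , λ p<n → ⊥-elim (p≮n p<n)

  Jump : ℕ → ℕ → Set
  Jump p d₀ = Σ ℕ λ d → Occ d × d₀ ≤ d × d ≤ p × p < d + L ×
              Σ ℕ λ d′ → Anchor (d + L) d′ × p < d′

  jump-or-advance : ∀ p d₀ → Occ d₀ → d₀ ≤ p → p < d₀ + L →
                    Jump p d₀ ⊎ Σ ℕ λ d₂ → Occ d₂ × d₀ < d₂ × d₂ ≤ p
  jump-or-advance p d₀ occ d₀≤p p<d₀+L with n ≤? d₀ + L
  ... | yes n≤d₀+L =
    inj₁ (d₀ , occ , ≤-refl , d₀≤p , p<d₀+L , d₀ + L , (≤-refl , λ lt → ⊥-elim (<⇒≱ lt n≤d₀+L)) , p<d₀+L)
  ... | no n≰d₀+L with cover (d₀ + L) (≰⇒> n≰d₀+L)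
  ...   | d₂ , occ₂ , d₂≤d₀+L , d₀+L<d₂+L with p <? d₂
  ...     | yes p<d₂ = inj₁ (d₀ , occ , ≤-refl , d₀≤p , p<d₀+L , d₂ , (d₂≤d₀+L , λ _ → occ₂ , d₀+L<d₂+L) , p<d₂)
  ...     | no p≮d₂  = inj₂ (d₂ , occ₂ , +-cancelʳ-< L d₀ d₂ d₀+L<d₂+L , ≮⇒≥ p≮d₂)

  jump-iter : ∀ p d₀ → Acc _<_ (p ∸ d₀) → Occ d₀ → d₀ ≤ p → p < d₀ + L → Jump p d₀
  jump-iter p d₀ (acc smaller) occ d₀≤p p<d₀+L with jump-or-advance p d₀ occ d₀≤p p<d₀+L
  ... | inj₁ j = j
  ... | inj₂ (d₂ , occ₂ , d₀<d₂ , d₂≤p)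
    with jump-iter p d₂ (smaller (∸-monoʳ-< d₀<d₂ d₂≤p)) occ₂ d₂≤p
           (<-≤-trans p<d₀+L (+-monoˡ-≤ L (<⇒≤ d₀<d₂)))
  ... | d , occ-d , d₂≤d , rest = d , occ-d , ≤-trans (<⇒≤ d₀<d₂) d₂≤d , rest

  jump : ∀ p d₀ → p < n → Anchor p d₀ → Jump p d₀
  jump p d₀ p<n (d₀≤p , covers) with covers p<n
  ... | occ , p<d₀+L = jump-iter p d₀ (<-wellFounded (p ∸ d₀)) occ d₀≤p p<d₀+L

  potential-grows : ∀ {p d₀ d d′} → d₀ ≤ d → p < d′ → suc L + (p + d₀) ≤ (d + L) + d′
  potential-grows {p} {d₀} {d} {d′} d₀≤d p<d′ = begin
    suc L + (p + d₀)  ≡⟨ reorder L p d₀ ⟩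
    (d₀ + L) + suc p  ≤⟨ +-mono-≤ (+-monoˡ-≤ L d₀≤d) p<d′ ⟩
    (d + L) + d′      ∎
    where
    open ≤-Reasoning
    reorder : ∀ a b c → suc a + (b + c) ≡ (c + a) + suc b
    reorder = solve-∀

module CoveredWord {A : Set} (w v : List A) (is-cover : IsCover v w) where
  n L : ℕ
  n = length w
  L = length v

  -- The cover, read with 0-based positions q ∈ [0, n).
  cover : ∀ q → q < n → Σ ℕ λ i → OccursAt v w i × i ≤ q × q < i + L
  cover q q<n with is-cover (suc q) (s≤s z≤n) q<n
  ... | i , occ , i+1≤q+1 , q<i+L = i , occ , ≤-pred (subst (_≤ suc q) (+-comm i 1) i+1≤q+1) , q<i+L

  open CoverGeometry n L (OccursAt v w) cover

  -- The occurrence covering the first letter starts at 0, so v is a prefix of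
  -- w and therefore of every prefix of w of length at least L.
  v-prefix-of : {prev rest : List A} → prev ++ rest ≡ w → 0 < n → L ≤ length prev →
                Σ (List A) λ z → prev ≡ v ++ z
  v-prefix-of {prev} {rest} prev++rest≡w 0<n L≤p with is-cover 1 ≤-refl 0<n
  ... | _ , ([] , y , w≡vy , _) , _ with ++-split v y prev rest (trans (sym w≡vy) (sym prev++rest≡w)) L≤p
  ...   | z , prev≡vz , _ = z , prev≡vz
  v-prefix-of _ _ _ | _ , (_ ∷ xs , _ , _ , refl) , s≤s |xs|+1≤0 , _ =
    ⊥-elim (1+n≰n (≤-trans (m≤n+m 1 (length xs)) |xs|+1≤0))

  NextPiece : List A → List A → ℕ → Set
  NextPiece prev rest d₀ = Σ ℕ λ end → Σ ℕ λ d′ →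
    Overhang prev rest end × Anchor end d′ × (suc L + (length prev + d₀) ≤ end + d′) × (length prev < end)

  next-piece : {prev rest : List A} {d₀ : ℕ} → prev ++ rest ≡ w → L ≤ length prev →
               length prev < n → Anchor (length prev) d₀ → NextPiece prev rest d₀
  next-piece {prev} {d₀ = d₀} prev++rest≡w L≤p p<n anchored
    with jump (length prev) d₀ p<n anchored
  ... | d , occ-d , d₀≤d , d≤p , p<d+L , d′ , anchored′ , p<d′
    with v-prefix-of prev++rest≡w (≤-<-trans z≤n p<n) L≤p
  ... | _ , prev≡vz =
    d + L , d′ , overhang prev≡vz occ-d prev++rest≡w d≤p (<⇒≤ p<d+L) , anchored′ ,
    potential-grows d₀≤d p<d′ , p<d+L

  Pieces : List A → List A → ℕ → Set
  Pieces prev rest d₀ = Σ (List (List A)) λ G →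
    ValidFactors prev G × concat G ≡ rest × length G * suc L + (length prev + d₀) ≤ n + n

  pieces : (prev rest : List A) (d₀ : ℕ) → Acc _<_ (length rest) → prev ++ rest ≡ w →
           L ≤ length prev → Anchor (length prev) d₀ → Pieces prev rest d₀
  pieces prev [] d₀ _ prev≡w _ (d₀≤p , _) =
    [] , tt , refl , +-mono-≤ (≤-reflexive p≡n) (≤-trans d₀≤p (≤-reflexive p≡n))
    where
    p≡n : length prev ≡ n
    p≡n = cong length (trans (sym (++-identityʳ prev)) prev≡w)
  pieces prev rest@(_ ∷ _) d₀ (acc smaller) prev++rest≡w L≤p anchored
    with next-piece prev++rest≡w L≤p p<n anchored
    where
    p<n : length prev < n
    p<n = subst (length prev <_) (sym (length-++-known prev rest (sym prev++rest≡w) refl))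
            (m<m+n (length prev) (s≤s z≤n))
  ... | end , d′ , (piece , rest′ , rest≡piece++rest′ , piece⊑prev , |prev|+|piece|≡end) ,
        anchored′ , grows , p<end =
    extend (pieces (prev ++ piece) rest′ d′ (smaller shorter) continues
             (≤-trans L≤p (length-++-≤ˡ prev))
             (subst (λ e → Anchor e d′) (sym |prev++piece|≡end) anchored′))
    where
    |prev++piece|≡end : length (prev ++ piece) ≡ end
    |prev++piece|≡end = trans (length-++ prev) |prev|+|piece|≡end

    -- the piece is non-empty, so the remaining suffix is shorter
    shorter : length rest′ < length rest
    shorter = subst (length rest′ <_) (sym (length-++-known piece rest′ rest≡piece++rest′ refl))
      (m<n+m (length rest′) (+-cancelˡ-< (length prev) 0 (length piece)
        (subst₂ _<_ (sym (+-identityʳ (length prev))) (sym |prev|+|piece|≡end) p<end)))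

    continues : (prev ++ piece) ++ rest′ ≡ w
    continues = trans (++-assoc prev piece rest′)
                  (trans (cong (prev ++_) (sym rest≡piece++rest′)) prev++rest≡w)

    extend : Pieces (prev ++ piece) rest′ d′ → Pieces prev rest d₀
    extend (G , valid-G , concat-G , bound) =
      piece ∷ G , (inj₁ piece⊑prev , valid-G) ,
      trans (cong (piece ++_) concat-G) (sym rest≡piece++rest′) ,
      pay-for-piece (length G) (suc L) (length prev + d₀) _ (n + n) bound
        (subst (λ e → suc L + (length prev + d₀) ≤ e + d′) (sym |prev++piece|≡end) grows)

  -- A shortest continuation of a prefix of length ≥ L has at most 2n/L factors:
  -- it is no longer than the greedy factorization of the same suffix.
  shortest-after-long-prefix : {prev : List A} {F : List (List A)} →
    prev ++ concat F ≡ w → Shortest prev F → L ≤ length prev → length F * L ≤ n + n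
  shortest-after-long-prefix {prev} {F} prev++F≡w shortest L≤p with anchor (length prev)
  ... | d₀ , anchored with pieces prev (concat F) d₀ (<-wellFounded _) prev++F≡w L≤p anchored
  ... | G , valid-G , concat-G , bound = begin
    length F * L                            ≤⟨ *-monoˡ-≤ L (shortest G valid-G concat-G) ⟩
    length G * L                            ≤⟨ *-monoʳ-≤ (length G) (n≤1+n L) ⟩
    length G * suc L                        ≤⟨ m≤m+n (length G * suc L) (length prev + d₀) ⟩
    length G * suc L + (length prev + d₀)   ≤⟨ bound ⟩
    n + n                                   ∎
    where open ≤-Reasoning

  counted? : (sf : ℕ × List A) → Dec (StartsEndsIn (L + 1) n sf)
  counted? = startsEndsIn? (L + 1) n

  -- Walk along F (prev = the factors already passed, of length s): a factor
  -- starting before position L is not counted; once the prefix has length ≥ L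
  -- all remaining factors are bounded by the previous lemma.
  counted-factors : (F : List (List A)) (prev : List A) (s : ℕ) → length prev ≡ s →
    ValidFactors prev F → prev ++ concat F ≡ w → Shortest prev F →
    length (filter counted? (withStarts s F)) * L ≤ n + n
  counted-factors [] _ _ _ _ _ _ = z≤n
  counted-factors (f ∷ F) prev s |prev|≡s (valid-f , valid-F) prev++fF≡w shortest with L ≤? s
  ... | yes L≤s = ≤-trans (*-monoˡ-≤ L at-most-all)
    (shortest-after-long-prefix {prev} {f ∷ F} prev++fF≡w shortest (subst (L ≤_) (sym |prev|≡s) L≤s))
    where
    at-most-all : length (filter counted? (withStarts s (f ∷ F))) ≤ length (f ∷ F)
    at-most-all = ≤-trans (length-filter counted? (withStarts s (f ∷ F))) (≤-reflexive (length-withStarts s (f ∷ F)))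
  ... | no L≰s =
    subst (λ t → length t * L ≤ n + n) (sym (filter-reject counted? starts-too-early))
      (counted-factors F (prev ++ f) (s + length f)
        (trans (length-++ prev) (cong (_+ length f) |prev|≡s)) valid-F
        (trans (++-assoc prev f (concat F)) prev++fF≡w) (shortest-tail {F = F} valid-f shortest))
    where
    starts-too-early : ¬ StartsEndsIn (L + 1) n (s , f)
    starts-too-early (L+1≤s+1 , _) = L≰s (+-cancelʳ-≤ 1 L s L+1≤s+1)

lemma2 : {A : Set} (w v : List A) (F : List (List A)) → IsFFactorization w F → IsCover v w → .{{_ : NonZero (length v)}} → length (FactorsIn (length v + 1) (length w) F) ≤ (2 * length w) / length v
lemma2 w v F ((concat-F , valid-F) , minimal) is-cover = begin
  k                  ≡⟨ sym (m*n/n≡m k L) ⟩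
  k * L / L          ≤⟨ /-monoˡ-≤ L (counted-factors F [] 0 refl valid-F concat-F shortest) ⟩
  (n + n) / L        ≡⟨ cong (λ t → (n + t) / L) (sym (+-identityʳ n)) ⟩
  (2 * n) / L        ∎
  where
  open ≤-Reasoning
  open CoveredWord w v is-cover using (n; L; counted-factors)
  k : ℕ
  k = length (FactorsIn (L + 1) n F)
  shortest : Shortest [] F
  shortest G valid-G concat-G = minimal G (trans concat-G concat-F , valid-G)
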